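{- Let $\mathbf E=(E,+,{}',0,1)$ be an effect algebra and $a,b,c\in E$. Then: (i) $(a\rightarrow 0)\rightarrow 0=\{a\}$; (ii) $a\rightarrow(b\rightarrow c)=a\rightarrow b'$; (iii) $a\rightarrow U(b)=a\rightarrow b$; (iv) $U(a)\rightarrow b=U(a)\rightarrow U(b)=U(a',b')\rightarrow a'=L(a')+L(a,b)$; (v) $a\rightarrow L(a,b)=\{a'\}$; (vi) $a\rightarrow U(a,b)=a'+L(a)$; (vii) $U(a\rightarrow U(a,b))=\{1\}$.
   Context: An effect algebra is a partial algebra $(E,+,{}',0,1)$ of type $(2,1,0,0)$ where $+$ is a partial binary operation such that for all $x,y,z\in E$: (E1) $x+y$ is defined iff $y+x$ is defined, and then $x+y=y+x$; (E2) $(x+y)+z$ is defined iff $x+(y+z)$ is defined, and then they are equal; (E3) $x'$ is the unique $u\in E$ with $x+u=1$; (E4) if $1+x$ is defined then $x=0$. The induced order is $x\leq y$ iff $x+z=y$ for some $z\in E$; $x+y$ is defined iff $x\leq y'$. For $A\subseteq E$, $L(A)=\{x\mid x\leq y\ \forall y\in A\}$, $U(A)=\{x\mid y\leq x\ \forall y\in A\}$; $L(a,b)=L(\{a,b\})$, $L(A,a)=L(A\cup\{a\})$, $L(A,B)=L(A\cup B)$, and analogously for $U$. For subsets $A,B$: $A\leq B$ means $u\leq v$ for all $u\in A,v\in B$; $A'=\{u'\mid u\in A\}$; if $A\leq x'$ then $x+A=\{x+u\mid u\in A\}$; if $A\leq B'$ then $A+B=\{u+v\mid u\in A,v\in B\}$.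 Implication: for elements $x,y$ and subsets $A,B$: $x\rightarrow y:=x'+L(x,y)$, $x\rightarrow B:=x'+L(x,B)$, $A\rightarrow y:=A'+L(A,y)$, $A\rightarrow B:=A'+L(A,B)$. A singleton set $\{x\}$ in the left argument is treated by the formula $A\rightarrow y$ with $A=\{x\}$. -}

module Defs where

open import Level using (0ℓ)
open import Data.Product using (Σ; ∃; ∃-syntax; _×_; _,_)
open import Relation.Binary.PropositionalEquality using (_≡_)
open import Relation.Unary using (Pred; ｛_｝; _∪_) public

-- An effect algebra (E, +, ′, 0, 1).  The partial operation + is given by its
-- graph:  Sum x y z  means "x + y is defined and equals z".
record EffectAlgebra : Set₁ where
  field
    Carrier : Set
    Sum     : Carrier → Carrier → Carrier → Set
    _′      : Carrier → Carrier
    𝟘 𝟙     : Carrier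
    Sum-functional : ∀ {x y z w} → Sum x y z → Sum x y w → z ≡ w
    E1 : ∀ {x y z} → Sum x y z → Sum y x z
    E2 : ∀ {x y z u w} → Sum x y u → Sum u z w → ∃[ v ] (Sum y z v × Sum x v w)
    E2′ : ∀ {x y z v w} → Sum y z v → Sum x v w → ∃[ u ] (Sum x y u × Sum u z w)
    E3-sum    : ∀ x → Sum x (x ′) 𝟙
    E3-unique : ∀ {x u} → Sum x u 𝟙 → u ≡ x ′
    E4 : ∀ {x z} → Sum 𝟙 x z → x ≡ 𝟘

  Subset : Set₁
  Subset = Pred Carrier 0ℓ

  _≤_ : Carrier → Carrier → Set
  x ≤ y = ∃[ z ] Sum x z y

  L : Subset → Subset
  L A x = ∀ y → A y → x ≤ y

  U : Subset → Subset
  U A x = ∀ y → A y → y ≤ x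

  -- the set {a, b}, so L(a,b) = L (pair a b), U(a,b) = U (pair a b)
  pair : Carrier → Carrier → Subset
  pair a b = ｛ a ｝ ∪ ｛ b ｝

  _′ˢ : Subset → Subset
  (A ′ˢ) z = ∃[ u ] (A u × z ≡ u ′)

  -- A + B = { u + v | u ∈ A, v ∈ B }  (used only where A ≤ B', so all sums defined)
  _⊕_ : Subset → Subset → Subset
  (A ⊕ B) z = ∃[ u ] ∃[ v ] (A u × B v × Sum u v z)

  -- A → B := A' + L(A, B); element arguments are singletons.
  _⇒_ : Subset → Subset → Subset
  A ⇒ B = (A ′ˢ) ⊕ L (A ∪ B)

  infixr 5 _⇒_

module Submission where

open import Defs
open import Data.Product using (_×_; _,_; proj₂; ∃-syntax)
open import Data.Sum using (inj₁; inj₂)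
open import Relation.Unary using (_≐_; _⊆_; ｛_｝; _∪_)
open import Relation.Unary.Properties using (≐-refl; ≐-sym; ≐-trans)
open import Relation.Binary.PropositionalEquality using (_≡_; refl; sym; trans; subst; subst₂)

-- L(A ∪ B) only depends on the lower cones of A and B, so the right argument of A → B may be
-- replaced by any set with the same lower cone: U(a) has that of a, and A → B itself, which
-- contains A' + 0 = A' and lies above A', has that of A'.  Moreover (U A)' = L(A'), a cone
-- L(X) containing 0 collapses A' + L(X) to A', and 1 = a' + a lies in a → U(a, b).

module Properties (𝐄 : EffectAlgebra) where
  open EffectAlgebra 𝐄

  private variable
    x y z : Carrier
    A B C D : Subset

  1′≡0 : 𝟙 ′ ≡ 𝟘
  1′≡0 = E4 (E3-sum 𝟙)

  1+0≡1 : Sum 𝟙 𝟘 𝟙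
  1+0≡1 = subst (λ t → Sum 𝟙 t 𝟙) 1′≡0 (E3-sum 𝟙)

  ′-involutive : ∀ x → x ′ ′ ≡ x
  ′-involutive x = sym (E3-unique (E1 (E3-sum x)))

  +-identityʳ : ∀ x → Sum x 𝟘 x
  +-identityʳ x with E2 (E1 (E3-sum x)) 1+0≡1
  ... | v , x+0≡v , x′+v≡1 = subst (Sum x 𝟘) (trans (E3-unique x′+v≡1) (′-involutive x)) x+0≡v

  sum-complement : Sum x y z → Sum y (z ′) (x ′)
  sum-complement {z = z} x+y≡z with E2 x+y≡z (E3-sum z)
  ... | v , y+z′≡v , x+v≡1 = subst (Sum _ (z ′)) (E3-unique x+v≡1) y+z′≡v

  zero-sum : Sum x y 𝟘 → y ≡ 𝟘
  zero-sum x+y≡0 with E2 x+y≡0 (E1 1+0≡1)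
  ... | _ , y+1≡v , _ = E4 (E1 y+1≡v)

  ≤-refl : x ≤ x
  ≤-refl {x} = 𝟘 , +-identityʳ x

  ≤-trans : x ≤ y → y ≤ z → x ≤ z
  ≤-trans (_ , x+u≡y) (_ , y+v≡z) with E2 x+u≡y y+v≡z
  ... | w , _ , x+w≡z = w , x+w≡z

  𝟘-minimum : 𝟘 ≤ x
  𝟘-minimum {x} = x , E1 (+-identityʳ x)

  𝟙-maximum : x ≤ 𝟙
  𝟙-maximum {x} = x ′ , E3-sum x

  ≤𝟘⇒≡𝟘 : x ≤ 𝟘 → x ≡ 𝟘
  ≤𝟘⇒≡𝟘 (_ , x+u≡0) = zero-sum (E1 x+u≡0)

  𝟙≤⇒≡𝟙 : 𝟙 ≤ x → x ≡ 𝟙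
  𝟙≤⇒≡𝟙 {x} (u , 1+u≡x) = Sum-functional 1+u≡x (subst (λ t → Sum 𝟙 t 𝟙) (sym (E4 1+u≡x)) 1+0≡1)

  ′-antitone : x ≤ y → (y ′) ≤ (x ′)
  ′-antitone (u , x+u≡y) = u , E1 (sum-complement x+u≡y)

  ′-reflects-≤ : (x ′) ≤ (y ′) → y ≤ x
  ′-reflects-≤ {x} {y} x′≤y′ =
    subst₂ _≤_ (′-involutive y) (′-involutive x) (′-antitone x′≤y′)

  _◁_ : Subset → Subset → Set
  A ◁ B = ∀ {y} → B y → ∃[ x ] (A x × x ≤ y)

  infix 4 _◁_

  ⊇⇒◁ : B ⊆ A → A ◁ B
  ⊇⇒◁ B⊆A {y} y∈B = y , B⊆A y∈B , ≤-refl

  ≐⇒◁ : A ≐ B → A ◁ B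
  ≐⇒◁ (_ , B⊆A) = ⊇⇒◁ B⊆A

  ◁-refl : A ◁ A
  ◁-refl = ⊇⇒◁ (λ x∈A → x∈A)

  ◁-trans : A ◁ B → B ◁ C → A ◁ C
  ◁-trans A◁B B◁C z∈C with B◁C z∈C
  ... | y , y∈B , y≤z with A◁B y∈B
  ... | x , x∈A , x≤y = x , x∈A , ≤-trans x≤y y≤z

  ◁-∪ : A ◁ B → A ◁ C → A ◁ (B ∪ C)
  ◁-∪ A◁B A◁C (inj₁ y∈B) = A◁B y∈B
  ◁-∪ A◁B A◁C (inj₂ y∈C) = A◁C y∈C

  ◁-∪-mono : A ◁ B → C ◁ D → (A ∪ C) ◁ (B ∪ D)
  ◁-∪-mono A◁B C◁D = ◁-∪ (◁-trans (⊇⇒◁ inj₁) A◁B) (◁-trans (⊇⇒◁ inj₂) C◁D)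

  ｛｝◁U : A x → ｛ x ｝ ◁ U A
  ｛｝◁U {x = x} x∈A y∈UA = x , refl , y∈UA x x∈A

  ◁⇒L⊆ : A ◁ B → L A ⊆ L B
  ◁⇒L⊆ A◁B z∈LA y y∈B with A◁B y∈B
  ... | x , x∈A , x≤y = ≤-trans (z∈LA x x∈A) x≤y

  L-cong : A ◁ B → B ◁ A → L A ≐ L B
  L-cong A◁B B◁A = ◁⇒L⊆ A◁B , ◁⇒L⊆ B◁A

  L-resp-≐ : A ≐ B → L A ≐ L B
  L-resp-≐ A≐B = L-cong (≐⇒◁ A≐B) (≐⇒◁ (≐-sym A≐B))

  L-∋𝟘 : A 𝟘 → L A ≐ ｛ 𝟘 ｝
  L-∋𝟘 0∈A = (λ z∈LA → sym (≤𝟘⇒≡𝟘 (z∈LA 𝟘 0∈A))) , λ { refl _ _ → 𝟘-minimum }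

  U-∋𝟙 : A 𝟙 → U A ≐ ｛ 𝟙 ｝
  U-∋𝟙 1∈A = (λ z∈UA → sym (𝟙≤⇒≡𝟙 (z∈UA 𝟙 1∈A))) , λ { refl _ _ → 𝟙-maximum }

  U｛｝◁｛｝ : U ｛ x ｝ ◁ ｛ x ｝
  U｛｝◁｛｝ {x} = ⊇⇒◁ {B = ｛ x ｝} {A = U ｛ x ｝} λ { refl _ refl → ≤-refl }

  ′ˢ-cong : A ≐ B → (A ′ˢ) ≐ (B ′ˢ)
  ′ˢ-cong (A⊆B , B⊆A) = (λ { (u , u∈A , z≡u′) → u , A⊆B u∈A , z≡u′ })
                      , (λ { (u , u∈B , z≡u′) → u , B⊆A u∈B , z≡u′ })

  ′ˢ-involutive : ((A ′ˢ) ′ˢ) ≐ A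
  ′ˢ-involutive {A} = (λ { (_ , (w , w∈A , refl) , refl) → subst A (sym (′-involutive w)) w∈A })
                    , (λ {z} z∈A → z ′ , (z , z∈A , refl) , sym (′-involutive z))

  ｛｝-′ˢ : (｛ x ｝ ′ˢ) ≐ ｛ x ′ ｝
  ｛｝-′ˢ {x} = (λ { (_ , refl , refl) → refl }) , λ { refl → x , refl , refl }

  pair-′ˢ : (pair (x ′) (y ′) ′ˢ) ≐ pair x y
  pair-′ˢ {x} {y} =
    (λ { (_ , inj₁ refl , refl) → inj₁ (sym (′-involutive x))
       ; (_ , inj₂ refl , refl) → inj₂ (sym (′-involutive y)) }) ,
    (λ { (inj₁ refl) → x ′ , inj₁ refl , sym (′-involutive x)
       ; (inj₂ refl) → y ′ , inj₂ refl , sym (′-involutive y) })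

  U-′ˢ : ((U A) ′ˢ) ≐ L (A ′ˢ)
  U-′ˢ {A} =
    (λ { (u , u∈UA , refl) _ (w , w∈A , refl) → ′-antitone (u∈UA w w∈A) }) ,
    (λ {z} z∈L → z ′ , (λ w w∈A → ′-reflects-≤ (subst (_≤ (w ′)) (sym (′-involutive z)) (z∈L (w ′) (w , w∈A , refl))))
                     , sym (′-involutive z))

  ⊕-cong : A ≐ B → C ≐ D → (A ⊕ C) ≐ (B ⊕ D)
  ⊕-cong (A⊆B , B⊆A) (C⊆D , D⊆C) =
    (λ { (u , v , u∈A , v∈C , u+v≡z) → u , v , A⊆B u∈A , C⊆D v∈C , u+v≡z }) ,
    (λ { (u , v , u∈B , v∈D , u+v≡z) → u , v , B⊆A u∈B , D⊆C v∈D , u+v≡z })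

  ⊕-comm : (A ⊕ B) ≐ (B ⊕ A)
  ⊕-comm = (λ { (u , v , u∈A , v∈B , u+v≡z) → v , u , v∈B , u∈A , E1 u+v≡z })
         , (λ { (u , v , u∈B , v∈A , u+v≡z) → v , u , v∈A , u∈B , E1 u+v≡z })

  ⊕-identityʳ : (A ⊕ ｛ 𝟘 ｝) ≐ A
  ⊕-identityʳ {A} = (λ { (u , _ , u∈A , refl , u+0≡z) → subst A (Sum-functional (+-identityʳ u) u+0≡z) u∈A })
                  , (λ {z} z∈A → z , 𝟘 , z∈A , refl , +-identityʳ z)

  ⇒◁′ˢ : (A ⇒ B) ◁ (A ′ˢ)
  ⇒◁′ˢ {y = y} y∈A′ = y , (y , 𝟘 , y∈A′ , (λ _ _ → 𝟘-minimum) , +-identityʳ y) , ≤-refl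

  ′ˢ◁⇒ : (A ′ˢ) ◁ (A ⇒ B)
  ′ˢ◁⇒ (u , v , u∈A′ , _ , u+v≡z) = u , u∈A′ , v , u+v≡z

  ⇒-≐-′ˢ : (A ∪ B) 𝟘 → (A ⇒ B) ≐ (A ′ˢ)
  ⇒-≐-′ˢ 0∈A∪B = ≐-trans (⊕-cong ≐-refl (L-∋𝟘 0∈A∪B)) ⊕-identityʳ

  ⇒-congʳ : B ◁ C → C ◁ B → (A ⇒ B) ≐ (A ⇒ C)
  ⇒-congʳ B◁C C◁B = ⊕-cong ≐-refl (L-cong (◁-∪-mono ◁-refl B◁C) (◁-∪-mono ◁-refl C◁B))

  ⇒𝟘-involutive : ((A ⇒ ｛ 𝟘 ｝) ⇒ ｛ 𝟘 ｝) ≐ A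
  ⇒𝟘-involutive = ≐-trans (⇒-≐-′ˢ (inj₂ refl)) (≐-trans (′ˢ-cong (⇒-≐-′ˢ (inj₂ refl))) ′ˢ-involutive)

  ⇒-⇒ʳ : (A ⇒ (B ⇒ C)) ≐ (A ⇒ (B ′ˢ))
  ⇒-⇒ʳ = ⇒-congʳ ⇒◁′ˢ ′ˢ◁⇒

  ⇒-U｛｝ : (A ⇒ U ｛ x ｝) ≐ (A ⇒ ｛ x ｝)
  ⇒-U｛｝ = ⇒-congʳ U｛｝◁｛｝ (｛｝◁U refl)

  U｛｝⇒U｛｝ : (U ｛ x ｝ ⇒ U ｛ y ｝) ≐ (L ｛ x ′ ｝ ⊕ L (pair x y))
  U｛｝⇒U｛｝ = ⊕-cong (≐-trans U-′ˢ (L-resp-≐ ｛｝-′ˢ))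
                     (L-cong (◁-∪-mono U｛｝◁｛｝ U｛｝◁｛｝) (◁-∪-mono (｛｝◁U refl) (｛｝◁U refl)))

  U-pair⇒ : (U (pair (x ′) (y ′)) ⇒ ｛ x ′ ｝) ≐ (L ｛ x ′ ｝ ⊕ L (pair x y))
  U-pair⇒ = ≐-trans (⊕-cong (≐-trans U-′ˢ (L-resp-≐ pair-′ˢ))
                            (L-cong (⊇⇒◁ inj₂) (◁-∪ (｛｝◁U (inj₁ refl)) ◁-refl)))
                    ⊕-comm

  ⇒-L : (A ⇒ L B) ≐ (A ′ˢ)
  ⇒-L = ⇒-≐-′ˢ (inj₂ λ _ _ → 𝟘-minimum)

  L-｛｝∪U : A x → L (｛ x ｝ ∪ U A) ≐ L ｛ x ｝
  L-｛｝∪U x∈A = L-cong (⊇⇒◁ inj₁) (◁-∪ ◁-refl (｛｝◁U x∈A))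

  ｛｝⇒U-pair : (｛ x ｝ ⇒ U (pair x y)) ≐ (｛ x ′ ｝ ⊕ L ｛ x ｝)
  ｛｝⇒U-pair = ⊕-cong ｛｝-′ˢ (L-｛｝∪U (inj₁ refl))

  U-｛｝⇒U-pair : U (｛ x ｝ ⇒ U (pair x y)) ≐ ｛ 𝟙 ｝
  U-｛｝⇒U-pair {x} = U-∋𝟙 (x ′ , x , (x , refl , refl) , x∈L , E1 (E3-sum x))
    where
      x∈L : L (｛ x ｝ ∪ U (pair x y)) x
      x∈L = proj₂ (L-｛｝∪U (inj₁ refl)) λ { _ refl → ≤-refl }

theorem5 : (𝐄 : EffectAlgebra) → let open EffectAlgebra 𝐄 in
    (a b c : Carrier) →
      (((｛ a ｝ ⇒ ｛ 𝟘 ｝) ⇒ ｛ 𝟘 ｝) ≐ ｛ a ｝)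
      × ((｛ a ｝ ⇒ (｛ b ｝ ⇒ ｛ c ｝)) ≐ (｛ a ｝ ⇒ ｛ b ′ ｝))
      × ((｛ a ｝ ⇒ U ｛ b ｝) ≐ (｛ a ｝ ⇒ ｛ b ｝))
      × ((U ｛ a ｝ ⇒ ｛ b ｝) ≐ (U ｛ a ｝ ⇒ U ｛ b ｝))
      × ((U ｛ a ｝ ⇒ U ｛ b ｝) ≐ (U (pair (a ′) (b ′)) ⇒ ｛ a ′ ｝))
      × ((U (pair (a ′) (b ′)) ⇒ ｛ a ′ ｝) ≐ (L ｛ a ′ ｝ ⊕ L (pair a b)))
      × ((｛ a ｝ ⇒ L (pair a b)) ≐ ｛ a ′ ｝)
      × ((｛ a ｝ ⇒ U (pair a b)) ≐ (｛ a ′ ｝ ⊕ L ｛ a ｝))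
      × (U (｛ a ｝ ⇒ U (pair a b)) ≐ ｛ 𝟙 ｝)
theorem5 𝐄 a b c =
    ⇒𝟘-involutive
  , ≐-trans ⇒-⇒ʳ (⇒-congʳ (≐⇒◁ ｛｝-′ˢ) (≐⇒◁ (≐-sym ｛｝-′ˢ)))
  , ⇒-U｛｝
  , ≐-sym ⇒-U｛｝
  , ≐-trans U｛｝⇒U｛｝ (≐-sym U-pair⇒)
  , U-pair⇒
  , ≐-trans ⇒-L ｛｝-′ˢ
  , ｛｝⇒U-pair
  , U-｛｝⇒U-pair
  where open Properties 𝐄
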